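{- Let $p$ be the partially ordered pattern of length 4 whose occurrences in a permutation $\pi=\pi_1\cdots\pi_n$ are the subsequences $\pi_{i_1}\pi_{i_2}\pi_{i_3}\pi_{i_4}$ with $i_1<i_2<i_3<i_4$ such that $\pi_{i_1}<\pi_{i_4}$, $\pi_{i_2}<\pi_{i_4}$ and $\pi_{i_2}<\pi_{i_3}$. Let $a(n)$ be the number of permutations of $[n]$ avoiding $p$. Then $a(0)=a(1)=1$, $a(2)=2$, and $a(n)=4a(n-1)-3a(n-2)+a(n-3)$ for $n\geq 3$; consequently $a(n)=\sum_{i=0}^{n-1}\binom{n+2i-1}{3i}$ for $n\geq 1$ and $$\sum_{n\geq 0}a(n)x^n=\frac{1-3x+x^2}{1-4x+3x^2-x^3}.$$
   Context: A permutation avoids a pattern if it contains no occurrence of it; the empty permutation counts for $n=0$. -}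

module Defs where

open import Data.Nat using (ℕ; zero; suc; _+_; _*_; _∸_)
open import Data.Nat.Combinatorics using (_C_)
open import Data.Integer using (ℤ; +_) renaming (_+_ to _+ℤ_; _*_ to _*ℤ_)
open import Data.Fin using (Fin; _<_; _<?_; _≟_)
open import Data.Fin.Properties using (any?; all?)
open import Data.Vec using (Vec; lookup; []; _∷_)
open import Data.List using (List; []; _∷_; length; filter; concatMap; allFin; map; upTo)
open import Data.Product using (Σ; ∃; _×_; _,_)
open import Relation.Nullary using (¬_; Dec; yes; no)
open import Relation.Nullary.Decidable using (_×-dec_; _→-dec_; ¬?)
open import Relation.Binary.PropositionalEquality using (_≡_)

IsPerm : ∀ {n} → Vec (Fin n) n → Set
IsPerm {n} π = ∀ (i j : Fin n) → lookup π i ≡ lookup π j → i ≡ j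

isPerm? : ∀ {n} (π : Vec (Fin n) n) → Dec (IsPerm π)
isPerm? π = all? (λ i → all? (λ j → (lookup π i ≟ lookup π j) →-dec (i ≟ j)))

Occ : ∀ {n} → Vec (Fin n) n → Fin n → Fin n → Fin n → Fin n → Set
Occ π i₁ i₂ i₃ i₄ =
  (i₁ < i₂) × (i₂ < i₃) × (i₃ < i₄) ×
  (lookup π i₁ < lookup π i₄) × (lookup π i₂ < lookup π i₄) × (lookup π i₂ < lookup π i₃)

Contains : ∀ {n} → Vec (Fin n) n → Set
Contains π = ∃ λ i₁ → ∃ λ i₂ → ∃ λ i₃ → ∃ λ i₄ → Occ π i₁ i₂ i₃ i₄

Avoids : ∀ {n} → Vec (Fin n) n → Set
Avoids π = ¬ Contains π

contains? : ∀ {n} (π : Vec (Fin n) n) → Dec (Contains π)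
contains? π = any? λ i₁ → any? λ i₂ → any? λ i₃ → any? λ i₄ →
  (i₁ <? i₂) ×-dec (i₂ <? i₃) ×-dec (i₃ <? i₄) ×-dec
  (lookup π i₁ <? lookup π i₄) ×-dec (lookup π i₂ <? lookup π i₄) ×-dec (lookup π i₂ <? lookup π i₃)

avoids? : ∀ {n} (π : Vec (Fin n) n) → Dec (Avoids π)
avoids? π = ¬? (contains? π)

allVecs : ∀ n k → List (Vec (Fin n) k)
allVecs n zero = [] ∷ []
allVecs n (suc k) = concatMap (λ x → map (x ∷_) (allVecs n k)) (allFin n)

perms : ∀ n → List (Vec (Fin n) n)
perms n = filter isPerm? (allVecs n n)

a : ℕ → ℕ
a n = length (filter avoids? (perms n))

FPS : Set
FPS = ℕ → ℤ

sumℤ : List ℤ → ℤ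
sumℤ [] = + 0
sumℤ (x ∷ xs) = x +ℤ sumℤ xs

_⊛_ : FPS → FPS → FPS
(f ⊛ g) n = sumℤ (map (λ k → f k *ℤ g (n ∸ k)) (upTo (suc n)))

-- Polynomial given by its coefficient list (constant term first).
poly : List ℤ → FPS
poly [] n = + 0
poly (c ∷ cs) zero = c
poly (c ∷ cs) (suc n) = poly cs n

genA : FPS
genA n = + a n

{-# OPTIONS --safe #-}
-- Every permutation of [n + 1] is x ◁ σ: a first entry x followed by a permutation σ of [n] whose
-- entries ≥ x are shifted up by one. Since the first letter of p is only compared with the last,
-- x ◁ σ avoids p iff σ avoids p and x exceeds the last letter of every occurrence in σ of the
-- pattern formed by the last three letters of p. The admissible values of x form an upper interval;
-- call its size the label. For an avoider of size at least 2, the label ℓ and whether its two largest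
-- values ascend (the type t) determine the labels and types of its children:
--   (1, t) has the single child (2, false);
--   (2 + r, t) has the children (3 + r, false), (3 + r, true) and r children (1, t) if t, (2, t) if not.
-- The number of avoiders of label 1, the number of label ≥ 2, and the total excess ℓ − 2 over each
-- type thus satisfy a linear system, whose elimination gives a(n + 3) + 3 a(n + 1) = 4 a(n + 2) + a(n).
-- The binomial sums satisfy the same recurrence by Pascal's rule, and the generating function
-- identity is the recurrence read off coefficientwise.
module Submission where

open import Defs
open import Data.Nat using (ℕ; zero; suc; _+_; _*_; _∸_; z≤n; s≤s)
import Data.Nat as ℕ
open import Data.Nat.Properties
  using (+-*-semiring; +-comm; +-identityʳ; *-identityʳ; *-zeroʳ; *-assoc; *-distribˡ-+; +-cancelʳ-≡;
         suc-injective; ≤-refl; ≤-reflexive; ≤-trans; ≤-antisym; ≤-pred; n≤1+n; m≤n+m; +-monoˡ-<;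
         <-irrefl; <-trans; <-≤-trans; <⇒≤; <⇒≢; <⇒≱; ≰⇒>; ≮⇒≥; ≤∧≢⇒<; n<1+n)
open import Data.Nat.Combinatorics using (_C_; k>n⇒nCk≡0; nCk+nC[k+1]≡[n+1]C[k+1])
open import Data.Nat.ListAction using (sum)
open import Data.Nat.ListAction.Properties using (sum-++)
open import Data.Nat.Tactic.RingSolver using (solve-∀; solve)
open import Data.Fin using (Fin; zero; suc; toℕ; fromℕ; inject₁; punchIn; punchOut; _<_; _≤_; _<?_)
open import Data.Fin.Properties
  using (toℕ<n; toℕ-fromℕ; toℕ-inject₁; toℕ-injective; punchIn-injective; punchIn-mono-≤;
         punchOut-injective; injective⇒≤; any?; all?; 0≢1+n)
import Data.Fin.Properties as Fin
open import Data.Vec using (Vec; []; _∷_; lookup)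
import Data.Vec as Vec
open import Data.Vec.Properties using (lookup-map)
open import Data.Vec.Membership.Propositional using (_∈_)
open import Data.Vec.Relation.Unary.Any using (here; there; index)
open import Data.Vec.Relation.Unary.Any.Properties using (lookup-index)
open import Data.List using (List; []; _∷_; _++_; map; upTo; applyUpTo; filter; length; concatMap; tabulate; allFin)
import Data.List as List
open import Data.List.Properties using (map-++; map-cong; map-∘)
open import Data.Integer using (ℤ; +_; -[1+_]) renaming (_+_ to _+ℤ_; _*_ to _*ℤ_; _-_ to _-ℤ_)
import Data.Integer.Properties as ℤ
import Data.Integer.Tactic.RingSolver as ℤ-Solver
open import Data.Bool using (Bool; true; false; if_then_else_)
open import Data.Product using (_×_; _,_; proj₁; proj₂; ∃; ∃₂)
open import Data.Sum using (_⊎_; inj₁; inj₂)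
open import Function using (_∘_; _⇔_; mk⇔; Equivalence)
open import Relation.Nullary using (Dec; yes; no; does; ¬_; contradiction)
open import Relation.Nullary.Decidable using (_×-dec_; _→-dec_; dec-true; dec-false; does-⇔)
open import Relation.Binary using (tri<; tri≈; tri>)
open import Relation.Binary.PropositionalEquality
open import Algebra.Properties.Semiring.Sum +-*-semiring
  using (sum-syntax; sum-cong-≗; sum-replicate-zero; sum-init-last; sum-remove; ∑-distrib-+; ∑-comm;
         *-distribˡ-sum; *-distribʳ-sum)

open ≡-Reasoning

𝟙 : ∀ {p} {P : Set p} → Dec P → ℕ
𝟙 p? = if does p? then 1 else 0

module _ {p} {P : Set p} where

  𝟙-yes : (p? : Dec P) → P → 𝟙 p? ≡ 1
  𝟙-yes (yes _) _ = refl
  𝟙-yes (no ¬p) p = contradiction p ¬p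

  𝟙-no : (p? : Dec P) → ¬ P → 𝟙 p? ≡ 0
  𝟙-no (yes p) ¬p = contradiction p ¬p
  𝟙-no (no _) _ = refl

  𝟙-*-cong : (p? : Dec P) {m n : ℕ} → (P → m ≡ n) → 𝟙 p? * m ≡ 𝟙 p? * n
  𝟙-*-cong (yes p) m≡n = cong (1 *_) (m≡n p)
  𝟙-*-cong (no _) _ = refl

module _ {p q} {P : Set p} {Q : Set q} where

  𝟙-⇔ : P ⇔ Q → (p? : Dec P) (q? : Dec Q) → 𝟙 p? ≡ 𝟙 q?
  𝟙-⇔ P⇔Q p? q? = cong (λ b → if b then 1 else 0) (does-⇔ P⇔Q p? q?)

  𝟙-× : (p? : Dec P) (q? : Dec Q) → 𝟙 (p? ×-dec q?) ≡ 𝟙 p? * 𝟙 q?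
  𝟙-× (yes _) (yes _) = refl
  𝟙-× (yes _) (no _) = refl
  𝟙-× (no _) _ = refl

∑-cong : ∀ {n} {f g : Fin n → ℕ} → (∀ i → f i ≡ g i) → ∑[ i < n ] f i ≡ ∑[ i < n ] g i
∑-cong = sum-cong-≗

sum-map-tabulate : ∀ {n} {A : Set} (g : A → ℕ) (f : Fin n → A) →
  sum (map g (tabulate f)) ≡ ∑[ x < n ] g (f x)
sum-map-tabulate {zero} g f = refl
sum-map-tabulate {suc n} g f = cong (_+_ (g (f zero))) (sum-map-tabulate g (f ∘ suc))

sum-map-concatMap : ∀ {A B : Set} (h : B → ℕ) (f : A → List B) xs →
  sum (map h (concatMap f xs)) ≡ sum (map (λ x → sum (map h (f x))) xs)
sum-map-concatMap h f [] = refl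
sum-map-concatMap h f (x ∷ xs) = begin
  sum (map h (f x ++ concatMap f xs))
    ≡⟨ cong sum (map-++ h (f x) (concatMap f xs)) ⟩
  sum (map h (f x) ++ map h (concatMap f xs))
    ≡⟨ sum-++ (map h (f x)) _ ⟩
  sum (map h (f x)) + sum (map h (concatMap f xs))
    ≡⟨ cong (_+_ (sum (map h (f x)))) (sum-map-concatMap h f xs) ⟩
  sum (map h (f x)) + sum (map (λ x → sum (map h (f x))) xs) ∎

sum-map-applyUpTo : ∀ (f h : ℕ → ℕ) n → sum (map f (applyUpTo h n)) ≡ ∑[ i < n ] f (h (toℕ i))
sum-map-applyUpTo f h zero = refl
sum-map-applyUpTo f h (suc n) = cong (_+_ (f (h 0))) (sum-map-applyUpTo f (h ∘ suc) n)

sum-map-upTo : ∀ (f : ℕ → ℕ) n → sum (map f (upTo n)) ≡ ∑[ i < n ] f (toℕ i)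
sum-map-upTo f = sum-map-applyUpTo f (λ i → i)

∑-toℕ-last : ∀ M (g : ℕ → ℕ) → ∑[ i < suc M ] g (toℕ i) ≡ ∑[ i < M ] g (toℕ i) + g M
∑-toℕ-last M g = begin
  ∑[ i < suc M ] g (toℕ i)
    ≡⟨ sum-init-last (g ∘ toℕ) ⟩
  ∑[ i < M ] g (toℕ (inject₁ i)) + g (toℕ (fromℕ M))
    ≡⟨ cong₂ _+_ (∑-cong {M} (λ i → cong g (toℕ-inject₁ i))) (cong g (toℕ-fromℕ M)) ⟩
  ∑[ i < M ] g (toℕ i) + g M ∎

∑Vec : ∀ n k → (Vec (Fin n) k → ℕ) → ℕ
∑Vec n zero h = h []
∑Vec n (suc k) h = ∑[ x < n ] ∑Vec n k (λ w → h (x ∷ w))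

sum-map-allVecs : ∀ n k (h : Vec (Fin n) k → ℕ) → sum (map h (allVecs n k)) ≡ ∑Vec n k h
sum-map-allVecs n zero h = +-identityʳ (h [])
sum-map-allVecs n (suc k) h = begin
  sum (map h (concatMap (λ x → map (x ∷_) (allVecs n k)) (allFin n)))
    ≡⟨ sum-map-concatMap h (λ x → map (x ∷_) (allVecs n k)) (allFin n) ⟩
  sum (map (λ x → sum (map h (map (x ∷_) (allVecs n k)))) (allFin n))
    ≡⟨ cong sum (map-cong (λ x → trans (cong sum (sym (map-∘ (allVecs n k))))
                                       (sum-map-allVecs n k (λ w → h (x ∷ w))))
                          (allFin n)) ⟩
  sum (map (λ x → ∑Vec n k (λ w → h (x ∷ w))) (allFin n))
    ≡⟨ sum-map-tabulate (λ x → ∑Vec n k (λ w → h (x ∷ w))) (λ x → x) ⟩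
  ∑Vec n (suc k) h ∎

∑Vec-cong : ∀ {n} k {g h : Vec (Fin n) k → ℕ} → (∀ w → g w ≡ h w) → ∑Vec n k g ≡ ∑Vec n k h
∑Vec-cong zero g≗h = g≗h []
∑Vec-cong {n} (suc k) g≗h = ∑-cong {n} (λ x → ∑Vec-cong k (λ w → g≗h (x ∷ w)))

∑Vec-zero : ∀ {n} k {h : Vec (Fin n) k → ℕ} → (∀ w → h w ≡ 0) → ∑Vec n k h ≡ 0
∑Vec-zero zero h≗0 = h≗0 []
∑Vec-zero {n} (suc k) h≗0 =
  trans (∑-cong {n} (λ x → ∑Vec-zero k (λ w → h≗0 (x ∷ w)))) (sum-replicate-zero n)

∑-∑Vec-comm : ∀ {m n} k (h : Fin m → Vec (Fin n) k → ℕ) →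
  ∑[ x < m ] ∑Vec n k (h x) ≡ ∑Vec n k (λ w → ∑[ x < m ] h x w)
∑-∑Vec-comm zero h = refl
∑-∑Vec-comm {m} {n} (suc k) h = begin
  ∑[ x < m ] ∑[ y < n ] ∑Vec n k (λ w → h x (y ∷ w))
    ≡⟨ ∑-comm (λ x y → ∑Vec n k (λ w → h x (y ∷ w))) ⟩
  ∑[ y < n ] ∑[ x < m ] ∑Vec n k (λ w → h x (y ∷ w))
    ≡⟨ ∑-cong {n} (λ y → ∑-∑Vec-comm k (λ x w → h x (y ∷ w))) ⟩
  ∑[ y < n ] ∑Vec n k (λ w → ∑[ x < m ] h x (y ∷ w)) ∎

∑Vec-distrib-+ : ∀ {n} k (g h : Vec (Fin n) k → ℕ) →
  ∑Vec n k (λ w → g w + h w) ≡ ∑Vec n k g + ∑Vec n k h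
∑Vec-distrib-+ zero g h = refl
∑Vec-distrib-+ {n} (suc k) g h =
  trans (∑-cong {n} (λ x → ∑Vec-distrib-+ k (λ w → g (x ∷ w)) (λ w → h (x ∷ w)))) (∑-distrib-+ {n} _ _)

-- A vector over Fin (suc n) avoiding the letter x is the image under punchIn x of a vector over Fin n.
∑Vec-punchIn : ∀ {n} (x : Fin (suc n)) k (h : Vec (Fin (suc n)) k → ℕ) → (∀ w → x ∈ w → h w ≡ 0) →
  ∑Vec (suc n) k h ≡ ∑Vec n k (λ w → h (Vec.map (punchIn x) w))
∑Vec-punchIn x zero h _ = refl
∑Vec-punchIn {n} x (suc k) h h≡0 = begin
  ∑[ y < suc n ] ∑Vec (suc n) k (λ w → h (y ∷ w))
    ≡⟨ sum-remove {i = x} (λ y → ∑Vec (suc n) k (λ w → h (y ∷ w))) ⟩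
  ∑Vec (suc n) k (λ w → h (x ∷ w)) + ∑[ y < n ] ∑Vec (suc n) k (λ w → h (punchIn x y ∷ w))
    ≡⟨ cong₂ _+_ (∑Vec-zero k (λ w → h≡0 (x ∷ w) (here refl)))
                 (∑-cong {n} (λ y → ∑Vec-punchIn x k (λ w → h (punchIn x y ∷ w))
                                                   (λ w x∈w → h≡0 _ (there x∈w)))) ⟩
  ∑[ y < n ] ∑Vec n k (λ w → h (punchIn x y ∷ Vec.map (punchIn x) w)) ∎

-- Counting avoiders by their first entry

Avoider : ∀ {n} → Vec (Fin n) n → Set
Avoider π = IsPerm π × Avoids π

avoider? : ∀ {n} (π : Vec (Fin n) n) → Dec (Avoider π)
avoider? π = isPerm? π ×-dec avoids? π

∑Avoiders : ∀ n → (Vec (Fin n) n → ℕ) → ℕ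
∑Avoiders n f = ∑Vec n n (λ π → 𝟙 (avoider? π) * f π)

length-filter-filter : ∀ {A : Set} {P Q : A → Set} (P? : ∀ x → Dec (P x)) (Q? : ∀ x → Dec (Q x)) xs →
  length (filter Q? (filter P? xs)) ≡ sum (map (λ x → 𝟙 (P? x ×-dec Q? x)) xs)
length-filter-filter P? Q? [] = refl
length-filter-filter P? Q? (x ∷ xs) with P? x
... | no _ = length-filter-filter P? Q? xs
... | yes _ with Q? x
...   | yes _ = cong suc (length-filter-filter P? Q? xs)
...   | no _ = length-filter-filter P? Q? xs

a≡∑Avoiders : ∀ n → a n ≡ ∑Avoiders n (λ _ → 1)
a≡∑Avoiders n = begin
  length (filter avoids? (filter isPerm? (allVecs n n)))
    ≡⟨ length-filter-filter isPerm? avoids? (allVecs n n) ⟩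
  sum (map (λ π → 𝟙 (avoider? π)) (allVecs n n))
    ≡⟨ sum-map-allVecs n n _ ⟩
  ∑Vec n n (λ π → 𝟙 (avoider? π))
    ≡⟨ ∑Vec-cong n (λ π → sym (*-identityʳ _)) ⟩
  ∑Avoiders n (λ _ → 1) ∎

∑Avoiders-cong : ∀ n {f g : Vec (Fin n) n → ℕ} → (∀ π → IsPerm π → f π ≡ g π) →
  ∑Avoiders n f ≡ ∑Avoiders n g
∑Avoiders-cong n f≡g = ∑Vec-cong n (λ π → 𝟙-*-cong (avoider? π) (λ (perm , _) → f≡g π perm))

∑Avoiders-distrib-+ : ∀ n (f g : Vec (Fin n) n → ℕ) →
  ∑Avoiders n (λ π → f π + g π) ≡ ∑Avoiders n f + ∑Avoiders n g
∑Avoiders-distrib-+ n f g =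
  trans (∑Vec-cong n (λ π → *-distribˡ-+ (𝟙 (avoider? π)) (f π) (g π))) (∑Vec-distrib-+ n _ _)

punchIn-mono-< : ∀ {n} (i : Fin (suc n)) {j k : Fin n} → j < k → punchIn i j < punchIn i k
punchIn-mono-< i {j} {k} j<k =
  Fin.≤∧≢⇒< (punchIn-mono-≤ i j k (<⇒≤ j<k)) (Fin.<⇒≢ j<k ∘ punchIn-injective i j k)

punchIn-cancel-< : ∀ {n} (i : Fin (suc n)) {j k : Fin n} → punchIn i j < punchIn i k → j < k
punchIn-cancel-< i {j} {k} lt = ≰⇒> (λ k≤j → <⇒≱ lt (punchIn-mono-≤ i k j k≤j))

toℕ-punchIn-< : ∀ {n} (i : Fin (suc n)) (j : Fin n) → j < i → toℕ (punchIn i j) ≡ toℕ j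
toℕ-punchIn-< (suc i) zero _ = refl
toℕ-punchIn-< (suc i) (suc j) (s≤s j<i) = cong suc (toℕ-punchIn-< i j j<i)

toℕ-punchIn-≥ : ∀ {n} (i : Fin (suc n)) (j : Fin n) → i ≤ j → toℕ (punchIn i j) ≡ suc (toℕ j)
toℕ-punchIn-≥ zero j _ = refl
toℕ-punchIn-≥ (suc i) (suc j) (s≤s i≤j) = cong suc (toℕ-punchIn-≥ i j i≤j)

≤⇒<punchIn : ∀ {n} (i : Fin (suc n)) (j : Fin n) → i ≤ j → i < punchIn i j
≤⇒<punchIn zero j _ = s≤s z≤n
≤⇒<punchIn (suc i) (suc j) (s≤s i≤j) = s≤s (≤⇒<punchIn i j i≤j)

<punchIn⇒≤ : ∀ {n} (i : Fin (suc n)) (j : Fin n) → i < punchIn i j → i ≤ j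
<punchIn⇒≤ zero j _ = z≤n
<punchIn⇒≤ (suc i) (suc j) (s≤s i<j) = s≤s (<punchIn⇒≤ i j i<j)

infixr 5 _◁_

_◁_ : ∀ {n k} → Fin (suc n) → Vec (Fin n) k → Vec (Fin (suc n)) (suc k)
x ◁ σ = x ∷ Vec.map (punchIn x) σ

module _ {n k} (x : Fin (suc n)) (σ : Vec (Fin n) k) where

  lookup-◁ : ∀ j → lookup (x ◁ σ) (suc j) ≡ punchIn x (lookup σ j)
  lookup-◁ j = lookup-map j (punchIn x) σ

  ◁-mono-< : ∀ {i j} → lookup σ i < lookup σ j → lookup (x ◁ σ) (suc i) < lookup (x ◁ σ) (suc j)
  ◁-mono-< {i} {j} lt = subst₂ _<_ (sym (lookup-◁ i)) (sym (lookup-◁ j)) (punchIn-mono-< x lt)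

  ◁-cancel-< : ∀ {i j} → lookup (x ◁ σ) (suc i) < lookup (x ◁ σ) (suc j) → lookup σ i < lookup σ j
  ◁-cancel-< {i} {j} lt = punchIn-cancel-< x (subst₂ _<_ (lookup-◁ i) (lookup-◁ j) lt)

  <◁⇔≤ : ∀ j → x < lookup (x ◁ σ) (suc j) ⇔ x ≤ lookup σ j
  <◁⇔≤ j = mk⇔ (λ lt → <punchIn⇒≤ x _ (subst (x <_) (lookup-◁ j) lt))
               (λ le → subst (x <_) (sym (lookup-◁ j)) (≤⇒<punchIn x _ le))

  toℕ-◁-below : ∀ j → lookup σ j < x → toℕ (lookup (x ◁ σ) (suc j)) ≡ toℕ (lookup σ j)
  toℕ-◁-below j lt = trans (cong toℕ (lookup-◁ j)) (toℕ-punchIn-< x _ lt)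

  toℕ-◁-above : ∀ j → x ≤ lookup σ j → toℕ (lookup (x ◁ σ) (suc j)) ≡ suc (toℕ (lookup σ j))
  toℕ-◁-above j le = trans (cong toℕ (lookup-◁ j)) (toℕ-punchIn-≥ x _ le)

  ◁-shift : ∀ {j m} → toℕ (lookup σ j) ≡ m → toℕ x ℕ.≤ m → toℕ (lookup (x ◁ σ) (suc j)) ≡ suc m
  ◁-shift {j} σj≡m x≤m = trans (toℕ-◁-above j (subst (toℕ x ℕ.≤_) (sym σj≡m) x≤m)) (cong suc σj≡m)

  ◁-unshift : ∀ {j m} → toℕ (lookup (x ◁ σ) (suc j)) ≡ suc m → toℕ x ℕ.≤ m → toℕ (lookup σ j) ≡ m
  ◁-unshift {j} {m} e x≤m with x Fin.≤? lookup σ j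
  ... | yes x≤σj = suc-injective (trans (sym (toℕ-◁-above j x≤σj)) e)
  ... | no x≰σj = contradiction (≤-trans (n≤1+n (suc m)) (≤-trans 2+m≤x x≤m)) (<-irrefl refl)
    where
    σj≡1+m = trans (sym (toℕ-◁-below j (≰⇒> x≰σj))) e
    2+m≤x = subst (λ v → suc v ℕ.≤ toℕ x) σj≡1+m (≰⇒> x≰σj)

◁-isPerm⇔ : ∀ {n} (x : Fin (suc n)) (σ : Vec (Fin n) n) → IsPerm (x ◁ σ) ⇔ IsPerm σ
◁-isPerm⇔ x σ = mk⇔ to from
  where
  to : IsPerm (x ◁ σ) → IsPerm σ
  to perm i j σi≡σj = Fin.suc-injective (perm (suc i) (suc j)
    (trans (lookup-◁ x σ i) (trans (cong (punchIn x) σi≡σj) (sym (lookup-◁ x σ j)))))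
  from : IsPerm σ → IsPerm (x ◁ σ)
  from perm zero zero _ = refl
  from perm zero (suc j) e = contradiction (sym (trans e (lookup-◁ x σ j))) (Fin.punchInᵢ≢i x _)
  from perm (suc i) zero e = contradiction (trans (sym (lookup-◁ x σ i)) e) (Fin.punchInᵢ≢i x _)
  from perm (suc i) (suc j) e =
    cong suc (perm i j (punchIn-injective x _ _ (trans (sym (lookup-◁ x σ i)) (trans e (lookup-◁ x σ j)))))

∈⇒¬IsPerm : ∀ {n} {x : Fin (suc n)} {w : Vec (Fin (suc n)) n} → x ∈ w → ¬ IsPerm (x ∷ w)
∈⇒¬IsPerm x∈w perm = 0≢1+n (perm zero (suc (index x∈w)) (lookup-index x∈w))

isPerm-surjective : ∀ {n} (σ : Vec (Fin n) n) → IsPerm σ → ∀ v → ∃ λ i → lookup σ i ≡ v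
isPerm-surjective {suc n} σ perm v with any? (λ i → lookup σ i Fin.≟ v)
... | yes found = found
... | no ¬found = contradiction (injective⇒≤ {f = f} f-injective) (<-irrefl refl)
  where
  v≢ : ∀ i → v ≢ lookup σ i
  v≢ i v≡σi = ¬found (i , sym v≡σi)
  f : Fin (suc n) → Fin n
  f i = punchOut (v≢ i)
  f-injective : ∀ {i j} → f i ≡ f j → i ≡ j
  f-injective {i} {j} fi≡fj = perm i j (punchOut-injective (v≢ i) (v≢ j) fi≡fj)

TailOcc : ∀ {n k} → Vec (Fin n) k → Fin k → Fin k → Fin k → Set
TailOcc σ j k l = (j < k) × (k < l) × (lookup σ j < lookup σ k) × (lookup σ j < lookup σ l)

-- A first entry of value y creates no occurrence of p.
Admissible : ∀ {n k} → ℕ → Vec (Fin n) k → Set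
Admissible y σ = ∀ j k l → TailOcc σ j k l → toℕ (lookup σ l) ℕ.< y

admissible? : ∀ {n k} y (σ : Vec (Fin n) k) → Dec (Admissible y σ)
admissible? y σ = all? λ j → all? λ k → all? λ l →
  ((j <? k) ×-dec (k <? l) ×-dec (lookup σ j <? lookup σ k) ×-dec (lookup σ j <? lookup σ l))
  →-dec (toℕ (lookup σ l) ℕ.<? y)

admissible-mono : ∀ {n k} {y y′} (σ : Vec (Fin n) k) → y ℕ.≤ y′ → Admissible y σ → Admissible y′ σ
admissible-mono σ y≤y′ adm j k l occ = <-≤-trans (adm j k l occ) y≤y′

admissible-top : ∀ {n k} {y} (σ : Vec (Fin n) k) → n ℕ.≤ y → Admissible y σ
admissible-top σ n≤y j k l _ = <-≤-trans (toℕ<n _) n≤y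

-- Opaque, so that conversion checking never unfolds the decision procedure.
opaque
  isAdmissible : ∀ {n k} → Vec (Fin n) k → ℕ → ℕ
  isAdmissible σ y = 𝟙 (admissible? y σ)

  isAdmissible-yes : ∀ {n k y} (σ : Vec (Fin n) k) → Admissible y σ → isAdmissible σ y ≡ 1
  isAdmissible-yes {y = y} σ = 𝟙-yes (admissible? y σ)

  isAdmissible-no : ∀ {n k y} (σ : Vec (Fin n) k) → ¬ Admissible y σ → isAdmissible σ y ≡ 0
  isAdmissible-no {y = y} σ = 𝟙-no (admissible? y σ)

  isAdmissible-*-cong : ∀ {n k y} (σ : Vec (Fin n) k) {m m′} →
    (Admissible y σ → m ≡ m′) → isAdmissible σ y * m ≡ isAdmissible σ y * m′
  isAdmissible-*-cong {y = y} σ = 𝟙-*-cong (admissible? y σ)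

  isAdmissible-⇔ : ∀ {n k y n′ k′ y′} (σ : Vec (Fin n) k) (τ : Vec (Fin n′) k′) →
    Admissible y σ ⇔ Admissible y′ τ → isAdmissible σ y ≡ isAdmissible τ y′
  isAdmissible-⇔ {y = y} {y′ = y′} σ τ P⇔Q = 𝟙-⇔ P⇔Q (admissible? y σ) (admissible? y′ τ)

  𝟙-×-isAdmissible : ∀ {n k p} {P : Set p} (p? : Dec P) y (σ : Vec (Fin n) k) →
    𝟙 (p? ×-dec admissible? y σ) ≡ 𝟙 p? * isAdmissible σ y
  𝟙-×-isAdmissible p? y σ = 𝟙-× p? (admissible? y σ)

module _ {n} (x : Fin (suc n)) (σ : Vec (Fin n) n) where

  ◁-avoids⇔ : Avoids (x ◁ σ) ⇔ (Avoids σ × Admissible (toℕ x) σ)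
  ◁-avoids⇔ = mk⇔ (λ av → avoids av , admissible av) (λ (av , adm) → avoids-◁ av adm)
    where
    avoids : Avoids (x ◁ σ) → Avoids σ
    avoids av (i₁ , i₂ , i₃ , i₄ , i₁<i₂ , i₂<i₃ , i₃<i₄ , v₁<v₄ , v₂<v₄ , v₂<v₃) =
      av (suc i₁ , suc i₂ , suc i₃ , suc i₄ , s≤s i₁<i₂ , s≤s i₂<i₃ , s≤s i₃<i₄ ,
          ◁-mono-< x σ v₁<v₄ , ◁-mono-< x σ v₂<v₄ , ◁-mono-< x σ v₂<v₃)

    admissible : Avoids (x ◁ σ) → Admissible (toℕ x) σ
    admissible av j k l (j<k , k<l , vj<vk , vj<vl) with toℕ (lookup σ l) ℕ.<? toℕ x
    ... | yes vl<x = vl<x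
    ... | no vl≮x = contradiction
      (zero , suc j , suc k , suc l , s≤s z≤n , s≤s j<k , s≤s k<l ,
       Equivalence.from (<◁⇔≤ x σ l) (≮⇒≥ vl≮x) , ◁-mono-< x σ vj<vl , ◁-mono-< x σ vj<vk) av

    avoids-◁ : Avoids σ → Admissible (toℕ x) σ → Avoids (x ◁ σ)
    avoids-◁ av adm (zero , suc j , suc k , suc l , _ , s≤s j<k , s≤s k<l , x<vl , vj<vl , vj<vk) =
      <-irrefl refl (<-≤-trans (adm j k l (j<k , k<l , ◁-cancel-< x σ vj<vk , ◁-cancel-< x σ vj<vl))
                               (Equivalence.to (<◁⇔≤ x σ l) x<vl))
    avoids-◁ av adm (suc i₁ , suc i₂ , suc i₃ , suc i₄ , s≤s i₁<i₂ , s≤s i₂<i₃ , s≤s i₃<i₄ , v₁<v₄ , v₂<v₄ , v₂<v₃) =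
      av (i₁ , i₂ , i₃ , i₄ , i₁<i₂ , i₂<i₃ , i₃<i₄ , ◁-cancel-< x σ v₁<v₄ , ◁-cancel-< x σ v₂<v₄ , ◁-cancel-< x σ v₂<v₃)
    avoids-◁ _ _ (_ , zero , _ , _ , () , _)
    avoids-◁ _ _ (_ , suc _ , zero , _ , _ , () , _)
    avoids-◁ _ _ (_ , suc _ , suc _ , zero , _ , _ , () , _)

  𝟙-avoider-◁ : 𝟙 (avoider? (x ◁ σ)) ≡ 𝟙 (avoider? σ) * isAdmissible σ (toℕ x)
  𝟙-avoider-◁ = trans (𝟙-⇔ avoider-◁⇔ (avoider? (x ◁ σ)) (avoider? σ ×-dec admissible? (toℕ x) σ))
                      (𝟙-×-isAdmissible (avoider? σ) (toℕ x) σ)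
    where
    avoider-◁⇔ : Avoider (x ◁ σ) ⇔ (Avoider σ × Admissible (toℕ x) σ)
    avoider-◁⇔ = mk⇔
      (λ (perm , av) → let (avσ , adm) = Equivalence.to ◁-avoids⇔ av in
                         (Equivalence.to (◁-isPerm⇔ x σ) perm , avσ) , adm)
      (λ ((perm , av) , adm) → Equivalence.from (◁-isPerm⇔ x σ) perm , Equivalence.from ◁-avoids⇔ (av , adm))

-- Every avoider of size n + 1 is x ◁ σ for a unique avoider σ of size n and admissible x.
∑Avoiders-suc : ∀ n (f : Vec (Fin (suc n)) (suc n) → ℕ) →
  ∑Avoiders (suc n) f ≡ ∑Avoiders n (λ σ → ∑[ x < suc n ] (isAdmissible σ (toℕ x) * f (x ◁ σ)))
∑Avoiders-suc n f = begin
  ∑[ x < suc n ] ∑Vec (suc n) n (λ w → h (x ∷ w))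
    ≡⟨ ∑-cong {suc n} (λ x → ∑Vec-punchIn x n (λ w → h (x ∷ w)) (λ w x∈w →
         cong (_* f (x ∷ w)) (𝟙-no (avoider? (x ∷ w)) (∈⇒¬IsPerm x∈w ∘ proj₁)))) ⟩
  ∑[ x < suc n ] ∑Vec n n (λ σ → h (x ◁ σ))
    ≡⟨ ∑-cong {suc n} (λ x → ∑Vec-cong n (λ σ →
         trans (cong (_* f (x ◁ σ)) (𝟙-avoider-◁ x σ)) (*-assoc (𝟙 (avoider? σ)) _ _))) ⟩
  ∑[ x < suc n ] ∑Vec n n (λ σ → 𝟙 (avoider? σ) * g x σ)
    ≡⟨ ∑-∑Vec-comm {suc n} n (λ x σ → 𝟙 (avoider? σ) * g x σ) ⟩
  ∑Vec n n (λ σ → ∑[ x < suc n ] (𝟙 (avoider? σ) * g x σ))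
    ≡⟨ ∑Vec-cong n (λ σ → sym (*-distribˡ-sum {suc n} (𝟙 (avoider? σ)) (λ x → g x σ))) ⟩
  ∑Avoiders n (λ σ → ∑[ x < suc n ] g x σ) ∎
  where
  h : Vec (Fin (suc n)) (suc n) → ℕ
  h π = 𝟙 (avoider? π) * f π
  g : Fin (suc n) → Vec (Fin n) n → ℕ
  g x σ = isAdmissible σ (toℕ x) * f (x ◁ σ)

-- Labels

label : ∀ {n k} → Vec (Fin n) k → ℕ
label {n} σ = ∑[ y < suc n ] isAdmissible σ (toℕ y)

isAdmissible-top : ∀ {n k y} (σ : Vec (Fin n) k) → n ℕ.≤ y → isAdmissible σ y ≡ 1
isAdmissible-top σ n≤y = isAdmissible-yes σ (admissible-top σ n≤y)

∑-inadmissible : ∀ {n k} (σ : Vec (Fin n) k) y → ¬ Admissible y σ → ∑[ z < suc y ] isAdmissible σ (toℕ z) ≡ 0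
∑-inadmissible σ y ¬adm = trans
  (∑-cong {suc y} (λ z → isAdmissible-no σ (¬adm ∘ admissible-mono σ (≤-pred (toℕ<n z)))))
  (sum-replicate-zero (suc y))

label-suc : ∀ {n k} (σ : Vec (Fin n) k) → label σ ≡ suc (∑[ y < n ] isAdmissible σ (toℕ y))
label-suc {n} σ = trans (∑-toℕ-last n (isAdmissible σ))
  (trans (cong (_+_ (∑[ y < n ] isAdmissible σ (toℕ y))) (isAdmissible-top σ ≤-refl)) (+-comm _ 1))

label-split : ∀ {n k} (σ : Vec (Fin (suc (suc n))) k) →
  label σ ≡ ∑[ z < suc n ] isAdmissible σ (toℕ z) + isAdmissible σ (suc n) + 1
label-split {n} σ = trans (∑-toℕ-last (suc (suc n)) (isAdmissible σ))
  (cong₂ _+_ (∑-toℕ-last (suc n) (isAdmissible σ)) (isAdmissible-top σ ≤-refl))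

label≡1 : ∀ {n k} (σ : Vec (Fin (suc n)) k) → ¬ Admissible n σ → label σ ≡ 1
label≡1 {n} σ ¬adm = trans (∑-toℕ-last (suc n) (isAdmissible σ))
  (cong₂ _+_ (∑-inadmissible σ n ¬adm) (isAdmissible-top σ ≤-refl))

label≡2 : ∀ {n k} (σ : Vec (Fin (suc (suc n))) k) → ¬ Admissible n σ → Admissible (suc n) σ → label σ ≡ 2
label≡2 {n} σ ¬adm adm = trans (label-split σ)
  (cong (_+ 1) (cong₂ _+_ (∑-inadmissible σ n ¬adm) (isAdmissible-yes σ adm)))

admissible-dichotomy : ∀ {n k} (σ : Vec (Fin (suc (suc n))) k) →
  (isAdmissible σ (suc n) ≡ 0 × ∑[ z < suc n ] isAdmissible σ (toℕ z) ≡ 0) ⊎ isAdmissible σ (suc n) ≡ 1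
admissible-dichotomy {n} σ with admissible? (suc n) σ
... | yes adm = inj₂ (isAdmissible-yes σ adm)
... | no ¬adm = inj₁ (isAdmissible-no σ ¬adm , ∑-inadmissible σ n (¬adm ∘ admissible-mono σ (n≤1+n n)))

AtMostOneAtLeast : ∀ {n k} → Fin (suc n) → Vec (Fin n) k → Set
AtMostOneAtLeast x σ = ∀ {i j} → i < j → x ≤ lookup σ i → ¬ x ≤ lookup σ j

module _ {n k} (x : Fin (suc n)) (σ : Vec (Fin n) k) (adm : Admissible (toℕ x) σ) (one : AtMostOneAtLeast x σ) where

  admissible-◁⇔ : ∀ y → Admissible y (x ◁ σ) ⇔ Admissible y σ
  admissible-◁⇔ y = mk⇔ to from
    where
    to : Admissible y (x ◁ σ) → Admissible y σ
    to adm◁ j k l occ@(j<k , k<l , vj<vk , vj<vl) =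
      subst (ℕ._< y) (toℕ-◁-below x σ l (adm j k l occ))
        (adm◁ (suc j) (suc k) (suc l) (s≤s j<k , s≤s k<l , ◁-mono-< x σ vj<vk , ◁-mono-< x σ vj<vl))
    from : Admissible y σ → Admissible y (x ◁ σ)
    from _ zero (suc k) (suc l) (_ , s≤s k<l , x<vk , x<vl) =
      contradiction (Equivalence.to (<◁⇔≤ x σ l) x<vl) (one k<l (Equivalence.to (<◁⇔≤ x σ k) x<vk))
    from admσ (suc j) (suc k) (suc l) (s≤s j<k , s≤s k<l , vj<vk , vj<vl) =
      subst (ℕ._< y) (sym (toℕ-◁-below x σ l (adm j k l occ))) (admσ j k l occ)
      where occ = (j<k , k<l , ◁-cancel-< x σ vj<vk , ◁-cancel-< x σ vj<vl)
    from _ _ zero _ (() , _)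
    from _ _ (suc _) zero (_ , () , _)

  label-◁ : label (x ◁ σ) ≡ suc (label σ)
  label-◁ = begin
    label (x ◁ σ)
      ≡⟨ ∑-toℕ-last (suc n) (isAdmissible (x ◁ σ)) ⟩
    ∑[ y < suc n ] isAdmissible (x ◁ σ) (toℕ y) + isAdmissible (x ◁ σ) (suc n)
      ≡⟨ cong₂ _+_ (∑-cong {suc n} (λ y → isAdmissible-⇔ (x ◁ σ) σ (admissible-◁⇔ (toℕ y))))
                   (isAdmissible-top (x ◁ σ) ≤-refl) ⟩
    label σ + 1
      ≡⟨ +-comm (label σ) 1 ⟩
    suc (label σ) ∎

TopAscending : ∀ {n k} → Vec (Fin (suc (suc n))) k → Set
TopAscending {n} σ = ∃₂ λ i j → i < j × toℕ (lookup σ i) ≡ n × toℕ (lookup σ j) ≡ suc n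

topAscending? : ∀ {n k} (σ : Vec (Fin (suc (suc n))) k) → Dec (TopAscending σ)
topAscending? {n} σ = any? λ i → any? λ j →
  (i <? j) ×-dec (toℕ (lookup σ i) ℕ.≟ n) ×-dec (toℕ (lookup σ j) ℕ.≟ suc n)

module _ {n k} (σ : Vec (Fin (suc (suc n))) k) {x : Fin (suc (suc (suc n)))} (x≡2+n : toℕ x ≡ suc (suc n)) where

  admissible-max : Admissible (toℕ x) σ
  admissible-max = subst (λ y → Admissible y σ) (sym x≡2+n) (admissible-top σ ≤-refl)

  ≰-max : ∀ v → ¬ x ≤ v
  ≰-max v x≤v = <-irrefl refl (<-≤-trans (toℕ<n v) (subst (ℕ._≤ toℕ v) x≡2+n x≤v))

  label-◁-max : label (x ◁ σ) ≡ suc (label σ)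
  label-◁-max = label-◁ x σ admissible-max (λ {i} _ x≤σi → contradiction x≤σi (≰-max (lookup σ i)))

  ¬topAscending-◁-max : ¬ TopAscending (x ◁ σ)
  ¬topAscending-◁-max (_ , suc c , _ , _ , σc≡2+n) =
    <-irrefl refl (subst (ℕ._< suc (suc n)) (trans (sym (toℕ-◁-below x σ c σc<x)) σc≡2+n) (toℕ<n (lookup σ c)))
    where
    σc<x : lookup σ c < x
    σc<x = subst (toℕ (lookup σ c) ℕ.<_) (sym x≡2+n) (toℕ<n (lookup σ c))

module _ {n} (σ : Vec (Fin (suc (suc n))) (suc (suc n))) (perm : IsPerm σ) where

  ≥1+n⇒≡1+n : ∀ (v : Fin (suc (suc n))) → suc n ℕ.≤ toℕ v → toℕ v ≡ suc n
  ≥1+n⇒≡1+n v 1+n≤v = ≤-antisym (≤-pred (toℕ<n v)) 1+n≤v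

  module _ {x : Fin (suc (suc (suc n)))} (x≡1+n : toℕ x ≡ suc n) where

    label-◁-second : Admissible (toℕ x) σ → label (x ◁ σ) ≡ suc (label σ)
    label-◁-second adm = label-◁ x σ adm one
      where
      one : AtMostOneAtLeast x σ
      one {i} {j} i<j x≤σi x≤σj =
        Fin.<⇒≢ i<j (perm i j (toℕ-injective (trans (top i x≤σi) (sym (top j x≤σj)))))
        where
        top : ∀ i → x ≤ lookup σ i → toℕ (lookup σ i) ≡ suc n
        top i x≤σi = ≥1+n⇒≡1+n (lookup σ i) (subst (ℕ._≤ toℕ (lookup σ i)) x≡1+n x≤σi)

    topAscending-◁-second : TopAscending (x ◁ σ)
    topAscending-◁-second = zero , suc c , s≤s z≤n , x≡1+n , ◁-shift x σ σc≡1+n (≤-reflexive x≡1+n)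
      where
      c = proj₁ (isPerm-surjective σ perm (fromℕ (suc n)))
      σc≡1+n : toℕ (lookup σ c) ≡ suc n
      σc≡1+n = trans (cong toℕ (proj₂ (isPerm-surjective σ perm (fromℕ (suc n))))) (toℕ-fromℕ (suc n))

module _ {n k} (σ : Vec (Fin (suc (suc n))) k) {x : Fin (suc (suc (suc n)))} (x≤n : toℕ x ℕ.≤ n) where

  topAscending-◁-small⇔ : TopAscending (x ◁ σ) ⇔ TopAscending σ
  topAscending-◁-small⇔ = mk⇔ to from
    where
    to : TopAscending (x ◁ σ) → TopAscending σ
    to (zero , _ , _ , x≡1+n , _) = contradiction (subst (ℕ._≤ n) x≡1+n x≤n) (<-irrefl refl)
    to (suc i , suc j , s≤s i<j , σi≡1+n , σj≡2+n) =
      i , j , i<j , ◁-unshift x σ σi≡1+n x≤n , ◁-unshift x σ σj≡2+n (≤-trans x≤n (n≤1+n n))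
    from : TopAscending σ → TopAscending (x ◁ σ)
    from (i , j , i<j , σi≡n , σj≡1+n) =
      suc i , suc j , s≤s i<j , ◁-shift x σ σi≡n x≤n , ◁-shift x σ σj≡1+n (≤-trans x≤n (n≤1+n n))

  x<◁ : ∀ {j m} → toℕ (lookup σ j) ≡ m → n ℕ.≤ m → x < lookup (x ◁ σ) (suc j)
  x<◁ {j} σj≡m n≤m = Equivalence.from (<◁⇔≤ x σ j) (subst (toℕ x ℕ.≤_) (sym σj≡m) (≤-trans x≤n n≤m))

  label-◁-ascending : TopAscending σ → label (x ◁ σ) ≡ 1
  label-◁-ascending (i , j , i<j , σi≡n , σj≡1+n) = label≡1 (x ◁ σ) ¬adm
    where
    ¬adm : ¬ Admissible (suc (suc n)) (x ◁ σ)
    ¬adm adm = <-irrefl (◁-shift x σ σj≡1+n (≤-trans x≤n (n≤1+n n)))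
      (adm zero (suc i) (suc j) (s≤s z≤n , s≤s i<j , x<◁ σi≡n ≤-refl , x<◁ σj≡1+n (n≤1+n n)))

module _ {n} (σ : Vec (Fin (suc (suc n))) (suc (suc n))) (perm : IsPerm σ) {x : Fin (suc (suc (suc n)))}
         (x≤n : toℕ x ℕ.≤ n) (adm : Admissible (toℕ x) σ) (¬asc : ¬ TopAscending σ) where

  private
    q : Fin (suc (suc n))
    q = proj₁ (isPerm-surjective σ perm (inject₁ (fromℕ n)))
    σq≡n : toℕ (lookup σ q) ≡ n
    σq≡n = trans (cong toℕ (proj₂ (isPerm-surjective σ perm (inject₁ (fromℕ n)))))
                 (trans (toℕ-inject₁ (fromℕ n)) (toℕ-fromℕ n))
    p : Fin (suc (suc n))
    p = proj₁ (isPerm-surjective σ perm (fromℕ (suc n)))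
    σp≡1+n : toℕ (lookup σ p) ≡ suc n
    σp≡1+n = trans (cong toℕ (proj₂ (isPerm-surjective σ perm (fromℕ (suc n))))) (toℕ-fromℕ (suc n))

    σ≡n≢σ≡1+n : ∀ {i j} → toℕ (lookup σ i) ≡ n → toℕ (lookup σ j) ≡ suc n → i ≢ j
    σ≡n≢σ≡1+n σi≡n σj≡1+n refl = <⇒≢ (n<1+n n) (trans (sym σi≡n) σj≡1+n)

  p<q : p < q
  p<q with Fin.<-cmp p q
  ... | tri< p<q _ _ = p<q
  ... | tri≈ _ p≡q _ = contradiction (sym p≡q) (σ≡n≢σ≡1+n σq≡n σp≡1+n)
  ... | tri> _ _ q<p = contradiction (q , p , q<p , σq≡n , σp≡1+n) ¬asc

  ¬admissible-1+n : ¬ Admissible (suc n) (x ◁ σ)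
  ¬admissible-1+n adm◁ = <-irrefl (◁-shift x σ σq≡n x≤n)
    (adm◁ zero (suc p) (suc q) (s≤s z≤n , s≤s p<q , x<◁ σ x≤n σp≡1+n (n≤1+n n) , x<◁ σ x≤n σq≡n ≤-refl))

  -- An entry σ j ≥ x in front of the value n + 1 would be below n, so (j, position of n + 1, q)
  -- would be an occurrence forcing n < x.
  ¬≥x-before-1+n : ∀ {j l} → j < l → x ≤ lookup σ j → toℕ (lookup σ l) ≢ suc n
  ¬≥x-before-1+n {j} {l} j<l x≤σj σl≡1+n with toℕ (lookup σ j) ℕ.≟ n
  ... | yes σj≡n = ¬asc (j , l , j<l , σj≡n , σl≡1+n)
  ... | no σj≢n with Fin.<-cmp q l
  ...   | tri< q<l _ _ = ¬asc (q , l , q<l , σq≡n , σl≡1+n)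
  ...   | tri≈ _ q≡l _ = σ≡n≢σ≡1+n σq≡n σl≡1+n q≡l
  ...   | tri> _ _ l<q =
    <-irrefl refl (<-≤-trans (subst (ℕ._< toℕ x) σq≡n (adm j l q occ)) (≤-trans x≤σj (<⇒≤ σj<n)))
    where
    σj≢1+n : toℕ (lookup σ j) ≢ suc n
    σj≢1+n σj≡1+n = Fin.<⇒≢ j<l (perm j l (toℕ-injective (trans σj≡1+n (sym σl≡1+n))))
    σj<n : toℕ (lookup σ j) ℕ.< n
    σj<n = ≤∧≢⇒< (≤-pred (≤∧≢⇒< (≤-pred (toℕ<n (lookup σ j))) σj≢1+n)) σj≢n
    occ : TailOcc σ j l q
    occ = j<l , l<q , subst (toℕ (lookup σ j) ℕ.<_) (sym σl≡1+n) (<-trans σj<n (n<1+n n)) ,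
          subst (toℕ (lookup σ j) ℕ.<_) (sym σq≡n) σj<n

  admissible-2+n : Admissible (suc (suc n)) (x ◁ σ)
  admissible-2+n zero (suc j) (suc l) (_ , s≤s j<l , x<σj , x<σl) =
    subst (ℕ._< suc (suc n)) (sym (toℕ-◁-above x σ l x≤σl))
      (s≤s (≤∧≢⇒< (≤-pred (toℕ<n (lookup σ l))) (¬≥x-before-1+n j<l x≤σj)))
    where
    x≤σj = Equivalence.to (<◁⇔≤ x σ j) x<σj
    x≤σl = Equivalence.to (<◁⇔≤ x σ l) x<σl
  admissible-2+n (suc j) (suc k) (suc l) (s≤s j<k , s≤s k<l , vj<vk , vj<vl) =
    subst (ℕ._< suc (suc n)) (sym (toℕ-◁-below x σ l σl<x))
      (<-≤-trans σl<x (≤-trans x≤n (≤-trans (n≤1+n n) (n≤1+n (suc n)))))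
    where σl<x = adm j k l (j<k , k<l , ◁-cancel-< x σ vj<vk , ◁-cancel-< x σ vj<vl)
  admissible-2+n _ zero _ (() , _)
  admissible-2+n _ (suc _) zero (_ , () , _)

  label-◁-descending : label (x ◁ σ) ≡ 2
  label-◁-descending = label≡2 (x ◁ σ) ¬admissible-1+n admissible-2+n

-- The succession rule

smallLabel : Bool → ℕ
smallLabel true = 1
smallLabel false = 2

label-◁-small : ∀ {n} (σ : Vec (Fin (suc (suc n))) (suc (suc n))) → IsPerm σ →
  ∀ {x : Fin (suc (suc (suc n)))} → toℕ x ℕ.≤ n → Admissible (toℕ x) σ →
  label (x ◁ σ) ≡ smallLabel (does (topAscending? σ))
label-◁-small σ perm {x} x≤n adm = by-type (topAscending? σ)
  where
  by-type : (asc? : Dec (TopAscending σ)) → label (x ◁ σ) ≡ smallLabel (does asc?)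
  by-type (yes asc) = label-◁-ascending σ x≤n asc
  by-type (no ¬asc) = label-◁-descending σ perm x≤n adm ¬asc

-- A function of the label and of whether the two largest values ascend.
Statistic : Set
Statistic = ℕ → Bool → ℕ

weigh : ∀ {n k} → Statistic → Vec (Fin (suc (suc n))) k → ℕ
weigh F σ = F (label σ) (does (topAscending? σ))

children : Statistic → Statistic
children F zero t = 0
children F 1 t = F 2 false
children F (suc (suc r)) t = F (3 + r) false + F (3 + r) true + r * F (smallLabel t) t

children-split : ∀ (F : Statistic) t {ℓ r g} → ℓ ≡ r + g + 1 → (g ≡ 0 × r ≡ 0) ⊎ g ≡ 1 →
  r * F (smallLabel t) t + g * F (suc ℓ) true + F (suc ℓ) false ≡ children F ℓ t
children-split F t refl (inj₁ (refl , refl)) = refl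
children-split F t {r = r} refl (inj₂ refl) rewrite +-comm (r + 1) 1 | +-comm r 1 =
  reorder (r * F (smallLabel t) t) (F (3 + r) true) (F (3 + r) false)
  where
  reorder : ∀ a b c → a + 1 * b + c ≡ c + b + a
  reorder = solve-∀

module _ {n} (σ : Vec (Fin (suc (suc n))) (suc (suc n))) (perm : IsPerm σ) (F : Statistic) where

  private
    t = does (topAscending? σ)
    term : Fin (suc (suc (suc n))) → ℕ
    term x = isAdmissible σ (toℕ x) * weigh F (x ◁ σ)

  term-max : ∀ {x} → toℕ x ≡ suc (suc n) → term x ≡ F (suc (label σ)) false
  term-max {x} x≡2+n = trans (cong₂ _*_ (isAdmissible-top σ (≤-reflexive (sym x≡2+n))) (cong₂ F label≡ type≡))
                             (+-identityʳ _)
    where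
    label≡ = label-◁-max σ x≡2+n
    type≡ = dec-false (topAscending? (x ◁ σ)) (¬topAscending-◁-max σ x≡2+n)

  term-second : ∀ {x} → toℕ x ≡ suc n → term x ≡ isAdmissible σ (suc n) * F (suc (label σ)) true
  term-second {x} x≡1+n = trans (isAdmissible-*-cong σ (λ adm → cong₂ F (label-◁-second σ perm x≡1+n adm) type≡))
                                (cong (λ y → isAdmissible σ y * F (suc (label σ)) true) x≡1+n)
    where
    type≡ = dec-true (topAscending? (x ◁ σ)) (topAscending-◁-second σ perm x≡1+n)

  term-small : ∀ z → term (inject₁ (inject₁ z)) ≡ isAdmissible σ (toℕ z) * F (smallLabel t) t
  term-small z = trans (isAdmissible-*-cong σ (λ adm → cong₂ F (label-◁-small σ perm x≤n adm) type≡))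
                       (cong (λ y → isAdmissible σ y * F (smallLabel t) t) x≡z)
    where
    x≡z : toℕ (inject₁ (inject₁ z)) ≡ toℕ z
    x≡z = trans (toℕ-inject₁ (inject₁ z)) (toℕ-inject₁ z)
    x≤n : toℕ (inject₁ (inject₁ z)) ℕ.≤ n
    x≤n = subst (ℕ._≤ n) (sym x≡z) (≤-pred (toℕ<n z))
    type≡ = does-⇔ (topAscending-◁-small⇔ σ x≤n) (topAscending? (inject₁ (inject₁ z) ◁ σ)) (topAscending? σ)

  ∑-children : ∑[ x < suc (suc (suc n)) ] term x ≡ children F (label σ) t
  ∑-children = begin
    ∑[ x < suc (suc (suc n)) ] term x
      ≡⟨ sum-init-last term ⟩
    ∑[ x < suc (suc n) ] term (inject₁ x) + term (fromℕ (suc (suc n)))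
      ≡⟨ cong (_+ term (fromℕ (suc (suc n)))) (sum-init-last (term ∘ inject₁)) ⟩
    ∑[ z < suc n ] term (inject₁ (inject₁ z)) + term (inject₁ (fromℕ (suc n))) + term (fromℕ (suc (suc n)))
      ≡⟨ cong₂ _+_ (cong₂ _+_ (∑-cong {suc n} term-small) (term-second {inject₁ (fromℕ (suc n))} x₂≡1+n))
                   (term-max {fromℕ (suc (suc n))} (toℕ-fromℕ (suc (suc n)))) ⟩
    ∑[ z < suc n ] (isAdmissible σ (toℕ z) * F (smallLabel t) t) + second + top
      ≡⟨ cong (λ s → s + second + top) (*-distribʳ-sum {suc n} (F (smallLabel t) t) (λ z → isAdmissible σ (toℕ z))) ⟨
    ∑[ z < suc n ] isAdmissible σ (toℕ z) * F (smallLabel t) t + second + top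
      ≡⟨ children-split F t (label-split σ) (admissible-dichotomy σ) ⟩
    children F (label σ) t ∎
    where
    second = isAdmissible σ (suc n) * F (suc (label σ)) true
    top = F (suc (label σ)) false
    x₂≡1+n : toℕ (inject₁ (fromℕ (suc n))) ≡ suc n
    x₂≡1+n = trans (toℕ-inject₁ (fromℕ (suc n))) (toℕ-fromℕ (suc n))

infixl 6 _⊕_

_⊕_ : Statistic → Statistic → Statistic
(F ⊕ G) ℓ t = F ℓ t + G ℓ t

levelSum : Statistic → ℕ → ℕ
levelSum F n = ∑Avoiders (suc (suc n)) (weigh F)

levelSum-children : ∀ F n → levelSum F (suc n) ≡ levelSum (children F) n
levelSum-children F n = trans (∑Avoiders-suc (suc (suc n)) (weigh F))
                              (∑Avoiders-cong (suc (suc n)) (λ σ perm → ∑-children σ perm F))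

levelSum-cong : ∀ {F G} → (∀ ℓ t → F ℓ t ≡ G ℓ t) → ∀ n → levelSum F n ≡ levelSum G n
levelSum-cong F≡G n = ∑Avoiders-cong (suc (suc n)) (λ σ _ → F≡G (label σ) (does (topAscending? σ)))

levelSum-⊕ : ∀ F G n → levelSum (F ⊕ G) n ≡ levelSum F n + levelSum G n
levelSum-⊕ F G n = ∑Avoiders-distrib-+ (suc (suc n)) (weigh F) (weigh G)

levelSum-step : ∀ {F} G → (∀ ℓ t → children F ℓ t ≡ G ℓ t) → ∀ n → levelSum F (suc n) ≡ levelSum G n
levelSum-step {F} G children-F n = trans (levelSum-children F n) (levelSum-cong children-F n)

labelOne labelAtLeastTwo excessAscending excessDescending : Statistic
labelOne 1 _ = 1
labelOne _ _ = 0
labelAtLeastTwo (suc (suc _)) _ = 1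
labelAtLeastTwo _ _ = 0
excessAscending ℓ true = ℓ ∸ 2
excessAscending ℓ false = 0
excessDescending ℓ true = 0
excessDescending ℓ false = ℓ ∸ 2

children-labelOne : ∀ ℓ t → children labelOne ℓ t ≡ excessAscending ℓ t
children-labelOne zero true = refl
children-labelOne zero false = refl
children-labelOne 1 true = refl
children-labelOne 1 false = refl
children-labelOne (suc (suc r)) true = *-identityʳ r
children-labelOne (suc (suc r)) false = *-zeroʳ r

children-labelAtLeastTwo : ∀ ℓ t →
  children labelAtLeastTwo ℓ t ≡ (labelOne ⊕ labelAtLeastTwo ⊕ labelAtLeastTwo ⊕ excessDescending) ℓ t
children-labelAtLeastTwo zero true = refl
children-labelAtLeastTwo zero false = refl
children-labelAtLeastTwo 1 true = refl
children-labelAtLeastTwo 1 false = refl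
children-labelAtLeastTwo (suc (suc r)) true = cong (_+_ 2) (*-zeroʳ r)
children-labelAtLeastTwo (suc (suc r)) false = cong (_+_ 2) (*-identityʳ r)

children-excessAscending : ∀ ℓ t →
  children excessAscending ℓ t ≡ (excessAscending ⊕ excessDescending ⊕ labelAtLeastTwo) ℓ t
children-excessAscending zero true = refl
children-excessAscending zero false = refl
children-excessAscending 1 true = refl
children-excessAscending 1 false = refl
children-excessAscending (suc (suc r)) true = arithmetic r
  where
  arithmetic : ∀ r → suc r + r * 0 ≡ r + 0 + 1
  arithmetic = solve-∀
children-excessAscending (suc (suc r)) false = arithmetic r
  where
  arithmetic : ∀ r → suc r + r * 0 ≡ r + 1
  arithmetic = solve-∀

children-excessDescending : ∀ ℓ t →
  children excessDescending ℓ t ≡ (excessAscending ⊕ excessDescending ⊕ labelAtLeastTwo) ℓ t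
children-excessDescending zero true = refl
children-excessDescending zero false = refl
children-excessDescending 1 true = refl
children-excessDescending 1 false = refl
children-excessDescending (suc (suc r)) true = arithmetic r
  where
  arithmetic : ∀ r → suc r + 0 + r * 0 ≡ r + 0 + 1
  arithmetic = solve-∀
children-excessDescending (suc (suc r)) false = arithmetic r
  where
  arithmetic : ∀ r → suc r + 0 + r * 0 ≡ r + 1
  arithmetic = solve-∀

-- The recurrence

Recurrence : (ℕ → ℕ) → Set
Recurrence f = ∀ n → f (3 + n) + 3 * f (1 + n) ≡ 4 * f (2 + n) + f n

system⇒recurrence : ∀ (f u v r d : ℕ → ℕ) →
  (∀ n → f n ≡ u n + v n) →
  (∀ n → u (suc n) ≡ r n) →
  (∀ n → v (suc n) ≡ u n + v n + v n + d n) →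
  (∀ n → r (suc n) ≡ r n + d n + v n) →
  (∀ n → d (suc n) ≡ r n + d n + v n) →
  Recurrence f
system⇒recurrence f u v r d ef eu ev er ed n
  rewrite ef (3 + n) | ef (1 + n) | ef (2 + n) | ef n
        | eu (2 + n) | ev (2 + n)
        | eu (1 + n) | ev (1 + n) | er (1 + n) | ed (1 + n)
        | eu n | ev n | er n | ed n
  with u n | v n | r n | d n
... | U | V | R | D = solve (U List.∷ V List.∷ R List.∷ D List.∷ List.[])

levelSum-⊕³ : ∀ F G H n → levelSum (F ⊕ G ⊕ H) n ≡ levelSum F n + levelSum G n + levelSum H n
levelSum-⊕³ F G H n = trans (levelSum-⊕ (F ⊕ G) H n) (cong (_+ levelSum H n) (levelSum-⊕ F G n))

levelSum-⊕⁴ : ∀ F G H K n → levelSum (F ⊕ G ⊕ H ⊕ K) n ≡ levelSum F n + levelSum G n + levelSum H n + levelSum K n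
levelSum-⊕⁴ F G H K n = trans (levelSum-⊕ (F ⊕ G ⊕ H) K n) (cong (_+ levelSum K n) (levelSum-⊕³ F G H n))

a-levelSum : ∀ n → a (suc (suc n)) ≡ levelSum labelOne n + levelSum labelAtLeastTwo n
a-levelSum n = begin
  a (suc (suc n))                          ≡⟨ a≡∑Avoiders (suc (suc n)) ⟩
  ∑Avoiders (suc (suc n)) (λ _ → 1)        ≡⟨ ∑Avoiders-cong (suc (suc n)) (λ σ _ → sym (weigh-one σ)) ⟩
  levelSum (labelOne ⊕ labelAtLeastTwo) n  ≡⟨ levelSum-⊕ labelOne labelAtLeastTwo n ⟩
  levelSum labelOne n + levelSum labelAtLeastTwo n ∎
  where
  one : ∀ ℓ t → (labelOne ⊕ labelAtLeastTwo) (suc ℓ) t ≡ 1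
  one zero t = refl
  one (suc ℓ) t = refl
  weigh-one : (σ : Vec (Fin (suc (suc n))) (suc (suc n))) → weigh (labelOne ⊕ labelAtLeastTwo) σ ≡ 1
  weigh-one σ = trans (cong (λ ℓ → (labelOne ⊕ labelAtLeastTwo) ℓ t) (label-suc σ)) (one ℓ⁻ t)
    where
    t = does (topAscending? σ)
    ℓ⁻ = ∑[ y < suc (suc n) ] isAdmissible σ (toℕ y)

levelSum-labelOne : ∀ n → levelSum labelOne (suc n) ≡ levelSum excessAscending n
levelSum-labelOne = levelSum-step excessAscending children-labelOne

levelSum-labelAtLeastTwo : ∀ n → levelSum labelAtLeastTwo (suc n)
  ≡ levelSum labelOne n + levelSum labelAtLeastTwo n + levelSum labelAtLeastTwo n + levelSum excessDescending n
levelSum-labelAtLeastTwo n =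
  trans (levelSum-step (labelOne ⊕ labelAtLeastTwo ⊕ labelAtLeastTwo ⊕ excessDescending) children-labelAtLeastTwo n)
        (levelSum-⊕⁴ labelOne labelAtLeastTwo labelAtLeastTwo excessDescending n)

levelSum-excessAscending : ∀ n → levelSum excessAscending (suc n)
  ≡ levelSum excessAscending n + levelSum excessDescending n + levelSum labelAtLeastTwo n
levelSum-excessAscending n =
  trans (levelSum-step (excessAscending ⊕ excessDescending ⊕ labelAtLeastTwo) children-excessAscending n)
        (levelSum-⊕³ excessAscending excessDescending labelAtLeastTwo n)

levelSum-excessDescending : ∀ n → levelSum excessDescending (suc n)
  ≡ levelSum excessAscending n + levelSum excessDescending n + levelSum labelAtLeastTwo n
levelSum-excessDescending n =
  trans (levelSum-step (excessAscending ⊕ excessDescending ⊕ labelAtLeastTwo) children-excessDescending n)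
        (levelSum-⊕³ excessAscending excessDescending labelAtLeastTwo n)

a-recurrence : Recurrence a
a-recurrence zero = refl
a-recurrence 1 = refl
a-recurrence (suc (suc n)) =
  system⇒recurrence (λ n → a (suc (suc n)))
    (levelSum labelOne) (levelSum labelAtLeastTwo) (levelSum excessAscending) (levelSum excessDescending)
    a-levelSum levelSum-labelOne levelSum-labelAtLeastTwo levelSum-excessAscending levelSum-excessDescending n

recurrence-unique : ∀ {f g} → Recurrence f → Recurrence g → f 0 ≡ g 0 → f 1 ≡ g 1 → f 2 ≡ g 2 → ∀ n → f n ≡ g n
recurrence-unique {f} {g} rec-f rec-g f0≡g0 f1≡g1 f2≡g2 n = proj₁ (agree n)
  where
  agree : ∀ n → f n ≡ g n × f (1 + n) ≡ g (1 + n) × f (2 + n) ≡ g (2 + n)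
  agree zero = f0≡g0 , f1≡g1 , f2≡g2
  agree (suc n) with agree n
  ... | e₀ , e₁ , e₂ = e₁ , e₂ , +-cancelʳ-≡ (3 * f (1 + n)) (f (3 + n)) (g (3 + n)) (begin
    f (3 + n) + 3 * f (1 + n)  ≡⟨ rec-f n ⟩
    4 * f (2 + n) + f n        ≡⟨ cong₂ (λ x y → 4 * x + y) e₂ e₀ ⟩
    4 * g (2 + n) + g n        ≡⟨ rec-g n ⟨
    g (3 + n) + 3 * g (1 + n)  ≡⟨ cong (λ x → g (3 + n) + 3 * x) e₁ ⟨
    g (3 + n) + 3 * f (1 + n)  ∎)

-- The binomial sum

pascal : ∀ m k → suc m C suc k ≡ m C k + m C suc k
pascal m k = sym (nCk+nC[k+1]≡[n+1]C[k+1] m k)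

-- Pascal's rule expands both sides into m C k + 3 m C (1 + k) + 6 m C (2 + k) + 4 m C (3 + k).
C-recurrence : ∀ m k → (3 + m) C (3 + k) + 3 * ((1 + m) C (3 + k)) ≡ 3 * ((2 + m) C (3 + k)) + m C (3 + k) + m C k
C-recurrence m k
  rewrite pascal (2 + m) (2 + k) | pascal (1 + m) (1 + k) | pascal (1 + m) (2 + k)
        | pascal m k | pascal m (1 + k) | pascal m (2 + k)
  with m C k | m C (1 + k) | m C (2 + k) | m C (3 + k)
... | c₀ | c₁ | c₂ | c₃ = solve (c₀ List.∷ c₁ List.∷ c₂ List.∷ c₃ List.∷ List.[])

binomialTerm : ℕ → ℕ → ℕ
binomialTerm n i = (n + 2 * i) C (3 * i)

binomialSum : ℕ → ℕ
binomialSum n = ∑[ i < suc n ] binomialTerm n (toℕ i)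

binomialTerm-suc : ∀ a n j → binomialTerm (a + n) (suc j) ≡ (a + (2 + n + 2 * j)) C (3 + 3 * j)
binomialTerm-suc a n j = cong₂ _C_ (top a n j) (bottom j)
  where
  top : ∀ a n j → a + n + 2 * suc j ≡ a + (2 + n + 2 * j)
  top = solve-∀
  bottom : ∀ j → 3 * suc j ≡ 3 + 3 * j
  bottom = solve-∀

shiftedTerm : ℕ → ℕ → ℕ
shiftedTerm n zero = 0
shiftedTerm n (suc j) = binomialTerm (2 + n) j

binomialTerm-recurrence : ∀ n i →
  binomialTerm (3 + n) i + 3 * binomialTerm (1 + n) i ≡ 3 * binomialTerm (2 + n) i + binomialTerm n i + shiftedTerm n i
binomialTerm-recurrence n zero = refl
binomialTerm-recurrence n (suc j) = begin
  binomialTerm (3 + n) (suc j) + 3 * binomialTerm (1 + n) (suc j)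
    ≡⟨ cong₂ (λ x y → x + 3 * y) (binomialTerm-suc 3 n j) (binomialTerm-suc 1 n j) ⟩
  (3 + m) C (3 + k) + 3 * ((1 + m) C (3 + k))
    ≡⟨ C-recurrence m k ⟩
  3 * ((2 + m) C (3 + k)) + m C (3 + k) + m C k
    ≡⟨ cong₂ (λ x y → 3 * x + y + m C k) (binomialTerm-suc 2 n j) (binomialTerm-suc 0 n j) ⟨
  3 * binomialTerm (2 + n) (suc j) + binomialTerm n (suc j) + shiftedTerm n (suc j) ∎
  where
  m = 2 + n + 2 * j
  k = 3 * j

binomialTerm-vanishes : ∀ n i → n ℕ.< i → binomialTerm n i ≡ 0
binomialTerm-vanishes n i n<i = k>n⇒nCk≡0 (subst (n + 2 * i ℕ.<_) (3i≡ i) (+-monoˡ-< (2 * i) n<i))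
  where
  3i≡ : ∀ i → i + 2 * i ≡ 3 * i
  3i≡ = solve-∀

binomialSum-extend : ∀ n k → ∑[ i < k + suc n ] binomialTerm n (toℕ i) ≡ binomialSum n
binomialSum-extend n zero = refl
binomialSum-extend n (suc k) = begin
  ∑[ i < suc (k + suc n) ] binomialTerm n (toℕ i)
    ≡⟨ ∑-toℕ-last (k + suc n) (binomialTerm n) ⟩
  ∑[ i < k + suc n ] binomialTerm n (toℕ i) + binomialTerm n (k + suc n)
    ≡⟨ cong₂ _+_ (binomialSum-extend n k) (binomialTerm-vanishes n (k + suc n) (m≤n+m (suc n) k)) ⟩
  binomialSum n + 0
    ≡⟨ +-identityʳ (binomialSum n) ⟩
  binomialSum n ∎

binomialSum-recurrence : Recurrence binomialSum
binomialSum-recurrence n = begin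
  binomialSum (3 + n) + 3 * binomialSum (1 + n)
    ≡⟨ cong (λ s → binomialSum (3 + n) + 3 * s) (binomialSum-extend (1 + n) 2) ⟨
  ∑[ i < 4 + n ] T (3 + n) i + 3 * ∑[ i < 4 + n ] T (1 + n) i
    ≡⟨ cong (_+_ (∑[ i < 4 + n ] T (3 + n) i)) (*-distribˡ-sum 3 (T (1 + n))) ⟩
  ∑[ i < 4 + n ] T (3 + n) i + ∑[ i < 4 + n ] (3 * T (1 + n) i)
    ≡⟨ ∑-distrib-+ (T (3 + n)) (λ i → 3 * T (1 + n) i) ⟨
  ∑[ i < 4 + n ] (T (3 + n) i + 3 * T (1 + n) i)
    ≡⟨ ∑-cong {4 + n} (λ i → binomialTerm-recurrence n (toℕ i)) ⟩
  ∑[ i < 4 + n ] (3 * T (2 + n) i + T n i + shiftedTerm n (toℕ i))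
    ≡⟨ ∑-distrib-+ (λ i → 3 * T (2 + n) i + T n i) (shiftedTerm n ∘ toℕ) ⟩
  ∑[ i < 4 + n ] (3 * T (2 + n) i + T n i) + binomialSum (2 + n)
    ≡⟨ cong (_+ binomialSum (2 + n)) (∑-distrib-+ (λ i → 3 * T (2 + n) i) (T n)) ⟩
  ∑[ i < 4 + n ] (3 * T (2 + n) i) + ∑[ i < 4 + n ] T n i + binomialSum (2 + n)
    ≡⟨ cong (λ s → s + ∑[ i < 4 + n ] T n i + binomialSum (2 + n)) (*-distribˡ-sum 3 (T (2 + n))) ⟨
  3 * ∑[ i < 4 + n ] T (2 + n) i + ∑[ i < 4 + n ] T n i + binomialSum (2 + n)
    ≡⟨ cong₂ (λ s t → 3 * s + t + binomialSum (2 + n)) (binomialSum-extend (2 + n) 1) (binomialSum-extend n 3) ⟩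
  3 * binomialSum (2 + n) + binomialSum n + binomialSum (2 + n)
    ≡⟨ regroup (binomialSum (2 + n)) (binomialSum n) ⟩
  4 * binomialSum (2 + n) + binomialSum n ∎
  where
  T : ℕ → Fin (4 + n) → ℕ
  T m i = binomialTerm m (toℕ i)
  regroup : ∀ x y → 3 * x + y + x ≡ 4 * x + y
  regroup = solve-∀

-- The generating function

denominator numerator : List ℤ
denominator = + 1 ∷ -[1+ 3 ] ∷ + 3 ∷ -[1+ 0 ] ∷ []
numerator = + 1 ∷ -[1+ 2 ] ∷ + 1 ∷ []

sumℤ-zeros : ∀ (t : ℕ → ℤ) (g : ℕ → ℕ) → (∀ i → t (g i) ≡ + 0) → ∀ M → sumℤ (map t (applyUpTo g M)) ≡ + 0
sumℤ-zeros t g t∘g≡0 zero = refl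
sumℤ-zeros t g t∘g≡0 (suc M) = cong₂ _+ℤ_ (t∘g≡0 0) (sumℤ-zeros t (g ∘ suc) (t∘g≡0 ∘ suc) M)

-- From degree 3 on, only the four coefficients of the denominator contribute.
⊛-denominator : ∀ (g : FPS) m →
  (poly denominator ⊛ g) (3 + m) ≡ (g (3 + m) +ℤ + 3 *ℤ g (1 + m)) -ℤ (+ 4 *ℤ g (2 + m) +ℤ g m)
⊛-denominator g m = collect (g (3 + m)) (g (2 + m)) (g (1 + m)) (g m) _ (sumℤ-zeros _ _ (λ _ → refl) m)
  where
  collect : ∀ x y z w r → r ≡ + 0 →
    + 1 *ℤ x +ℤ (-[1+ 3 ] *ℤ y +ℤ (+ 3 *ℤ z +ℤ (-[1+ 0 ] *ℤ w +ℤ r)))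
      ≡ (x +ℤ + 3 *ℤ z) -ℤ (+ 4 *ℤ y +ℤ w)
  collect x y z w _ refl = ring x y z w
    where
    ring : ∀ x y z w → + 1 *ℤ x +ℤ (-[1+ 3 ] *ℤ y +ℤ (+ 3 *ℤ z +ℤ (-[1+ 0 ] *ℤ w +ℤ + 0)))
                         ≡ (x +ℤ + 3 *ℤ z) -ℤ (+ 4 *ℤ y +ℤ w)
    ring = ℤ-Solver.solve-∀

recurrence⇒⊛-denominator : ∀ {f} → Recurrence f → ∀ m → (poly denominator ⊛ (λ n → + f n)) (3 + m) ≡ + 0
recurrence⇒⊛-denominator {f} rec m = trans (⊛-denominator (λ n → + f n) m) (ℤ.i≡j⇒i-j≡0 (begin
  + f (3 + m) +ℤ + 3 *ℤ + f (1 + m)  ≡⟨ cong (+ f (3 + m) +ℤ_) (ℤ.pos-* 3 (f (1 + m))) ⟨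
  + f (3 + m) +ℤ + (3 * f (1 + m))   ≡⟨ ℤ.pos-+ (f (3 + m)) (3 * f (1 + m)) ⟨
  + (f (3 + m) + 3 * f (1 + m))      ≡⟨ cong +_ (rec m) ⟩
  + (4 * f (2 + m) + f m)            ≡⟨ ℤ.pos-+ (4 * f (2 + m)) (f m) ⟩
  + (4 * f (2 + m)) +ℤ + f m         ≡⟨ cong (_+ℤ + f m) (ℤ.pos-* 4 (f (2 + m))) ⟩
  + 4 *ℤ + f (2 + m) +ℤ + f m        ∎))

a-binomial : ∀ n → a (suc n) ≡ sum (map (λ i → (suc n + 2 * i ∸ 1) C (3 * i)) (upTo (suc n)))
a-binomial n = begin
  a (suc n)
    ≡⟨ recurrence-unique {λ n → a (suc n)} {binomialSum} (a-recurrence ∘ suc) binomialSum-recurrence refl refl refl n ⟩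
  binomialSum n
    ≡⟨ sum-map-upTo (binomialTerm n) (suc n) ⟨
  sum (map (binomialTerm n) (upTo (suc n))) ∎

a-generatingFunction : ∀ m → (poly denominator ⊛ genA) m ≡ poly numerator m
a-generatingFunction zero = refl
a-generatingFunction 1 = refl
a-generatingFunction 2 = refl
a-generatingFunction (suc (suc (suc m))) = recurrence⇒⊛-denominator {a} a-recurrence m

theorem14 : (a 0 ≡ 1) × (a 1 ≡ 1) × (a 2 ≡ 2)
    × (∀ n → a (3 + n) + 3 * a (1 + n) ≡ 4 * a (2 + n) + a n)
    × (∀ n → a (suc n) ≡ sum (map (λ i → (suc n + 2 * i ∸ 1) C (3 * i)) (upTo (suc n))))
    × (∀ m → (poly (+ 1 ∷ -[1+ 3 ] ∷ + 3 ∷ -[1+ 0 ] ∷ []) ⊛ genA) m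
             ≡ poly (+ 1 ∷ -[1+ 2 ] ∷ + 1 ∷ []) m)
theorem14 = refl , refl , refl , a-recurrence , a-binomial , a-generatingFunction
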